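{- For every integer $\ell \ge 1$, the largest integer $k$ such that $J(\ell,k) \neq 0$ is $\left\lfloor \frac{2\ell-1}{3} \right\rfloor$.
   Context: Let $\pi=\pi_1\cdots\pi_n$ be a permutation of $[n]$. An entry $\pi_i$ is a left-to-right minimum if $\pi_j>\pi_i$ for all $j<i$. Let the left-to-right minima of $\pi$ be at positions $k_1<k_2<\dots<k_a$ (so $\pi_{k_1}>\dots>\pi_{k_a}$), and set $\pi_{k_0}:=n+1$ and $k_{a+1}:=n+1$. The staircase grid $B_a$ consists of the boxes $(i,j)$ with $1\le i\le j\le a$, where $i$ is the row index counted from the top and $j$ is the column index counted from the left (so the top row has $a$ boxes, the next row $a-1$ boxes, right-aligned, etc.). The staircase encoding of $\pi$ fills box $(i,j)$ of $B_a$ with the number of indices $p$ with $k_j<p<k_{j+1}$ and $\pi_{k_i}<\pi_p<\pi_{k_{i-1}}$. A permutation $\pi$ contains $132$ if there are indices $p<q<r$ with $\pi_p<\pi_r<\pi_q$, and avoids $132$ otherwise. For integers $\ell\ge1$, $k\ge0$, let $J(\ell,k)$ denote the number of $132$-avoiding permutations of $[\ell]$ whose staircase encoding has exactly $k$ nonzero boxes. -}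

module Defs where

open import Data.Nat using (ℕ; zero; suc; _+_; _∸_; _<ᵇ_; _≡ᵇ_)
open import Data.Bool using (Bool; true; false; _∧_; _∨_; not; if_then_else_)
open import Data.List using (List; []; _∷_; length; map; upTo; concatMap; _++_; [_])
open import Data.Product using (_×_; _,_; proj₁; proj₂)

-- Conventions: a permutation of [n] is represented 0-based as a list
-- π = π_0 … π_{n-1} of the values 0 … n-1 (each exactly once).
-- Shifting positions and values by one does not change any of the
-- notions below (left-to-right minima, 132 pattern, staircase counts).

boolFilter : {A : Set} → (A → Bool) → List A → List A
boolFilter p []       = []
boolFilter p (x ∷ xs) = if p x then x ∷ boolFilter p xs else boolFilter p xs

allᵇ : {A : Set} → (A → Bool) → List A → Bool
allᵇ p []       = true
allᵇ p (x ∷ xs) = p x ∧ allᵇ p xs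

anyᵇ : {A : Set} → (A → Bool) → List A → Bool
anyᵇ p []       = false
anyᵇ p (x ∷ xs) = p x ∨ anyᵇ p xs

-- p-th entry (0-based), default 0 when out of range
nth : List ℕ → ℕ → ℕ
nth []       _       = 0
nth (x ∷ xs) zero    = x
nth (x ∷ xs) (suc i) = nth xs i

elemᵇ : ℕ → List ℕ → Bool
elemᵇ x []       = false
elemᵇ x (y ∷ ys) = (x ≡ᵇ y) ∨ elemᵇ x ys

distinctᵇ : List ℕ → Bool
distinctᵇ []       = true
distinctᵇ (x ∷ xs) = not (elemᵇ x xs) ∧ distinctᵇ xs

isPermᵇ : ℕ → List ℕ → Bool
isPermᵇ n π = (length π ≡ᵇ n) ∧ (allᵇ (λ x → x <ᵇ n) π ∧ distinctᵇ π)

allLists : ℕ → ℕ → List (List ℕ)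
allLists zero    m = [] ∷ []
allLists (suc l) m = concatMap (λ x → map (x ∷_) (allLists l m)) (upTo m)

perms : ℕ → List (List ℕ)
perms n = boolFilter (isPermᵇ n) (allLists n n)

contains132ᵇ : List ℕ → Bool
contains132ᵇ π =
  anyᵇ (λ r → anyᵇ (λ q → anyᵇ (λ p →
        (p <ᵇ q) ∧ ((q <ᵇ r) ∧ ((nth π p <ᵇ nth π r) ∧ (nth π r <ᵇ nth π q))))
      (upTo n)) (upTo n)) (upTo n)
  where n = length π

avoids132ᵇ : List ℕ → Bool
avoids132ᵇ π = not (contains132ᵇ π)

isLRminᵇ : List ℕ → ℕ → Bool
isLRminᵇ π i = allᵇ (λ j → nth π i <ᵇ nth π j) (upTo i)

lrMinPositions : List ℕ → List ℕ
lrMinPositions π = boolFilter (isLRminᵇ π) (upTo (length π))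

-- With a = number of LR minima, positions
-- K j = k_j for 1 ≤ j ≤ a, and K (a+1) = n  (the 0-based analogue of n+1);
-- values V i = π_{k_i} for 1 ≤ i ≤ a, and V 0 = n  (0-based analogue of n+1).
module _ (π : List ℕ) where
  private
    n  = length π
    ks = lrMinPositions π
    a  = length ks
    K : ℕ → ℕ
    K j = nth (ks ++ [ n ]) (j ∸ 1)
    V : ℕ → ℕ
    V i = nth (n ∷ map (nth π) ks) i

  boxEntry : ℕ → ℕ → ℕ
  boxEntry i j = length (boolFilter
    (λ p → (K j <ᵇ p) ∧ ((p <ᵇ K (suc j)) ∧ ((V i <ᵇ nth π p) ∧ (nth π p <ᵇ V (i ∸ 1)))))
    (upTo n))

  boxes : List (ℕ × ℕ)
  boxes = concatMap (λ j → concatMap (λ i → [ (suc i , suc j) ]) (upTo (suc j))) (upTo a)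

  nonzeroBoxes : ℕ
  nonzeroBoxes = length (boolFilter (λ b → not (boxEntry (proj₁ b) (proj₂ b) ≡ᵇ 0)) boxes)

J : ℕ → ℕ → ℕ
J ℓ k = length (boolFilter (λ π → avoids132ᵇ π ∧ (nonzeroBoxes π ≡ᵇ k)) (perms ℓ))

module Submission where

-- Let π avoid 132, have a left-to-right minima and k nonzero
-- boxes.  (1) Choosing a position counted in each nonzero box gives k distinct
-- positions, none of them an LR-minimum position, so k + a ≤ n.  (2) Coding a
-- nonzero box by its column if it is topmost in that column, and by its row
-- otherwise, is injective for 132-avoiders (two such boxes in a row would
-- create a 132), with at most a + (a − 1) codes, so k ≤ 2a − 1.  Hence
-- 3k ≤ 2n − 1.  Both counts use one pigeonhole principle for lists.
--
-- The permutations E 1 = 0, E 2 = 01, E 3 = 012 and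
-- E (ℓ+3) = ℓ (ℓ+1) E ℓ (ℓ+2) avoid 132, and each step adds the two nonzero
-- boxes (1 , 1) and (1 , a) on top of the old ones shifted diagonally.

open import Defs
open import Data.Nat using (ℕ; zero; suc; pred; _+_; _*_; _∸_; _/_; _≤_; _<_; _<ᵇ_; _≡ᵇ_; z≤n; s≤s; _<?_)
open import Data.Nat.Properties
open import Data.Nat.DivMod using (m*n/n≡m; /-monoˡ-≤; +-distrib-/-∣ʳ)
open import Data.Nat.Divisibility using (divides)
open import Data.Nat.Tactic.RingSolver using (solve-∀)
open import Data.Bool using (Bool; true; false; _∧_; not; if_then_else_)
open import Data.Bool.Properties using (T-≡)
open import Data.Fin using (Fin) renaming (zero to fzero; suc to fsuc)
open import Data.Fin.Properties using (injective⇒≤)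
open import Data.List using (List; []; _∷_; length; map; upTo; applyUpTo; concatMap; lookup; _++_; [_])
open import Data.List.Properties
  using (length-++; length-map; length-upTo; map-upTo; map-++; map-∘; map-cong-local; upTo-∷ʳ; ++-identityʳ)
open import Data.List.Membership.Propositional using (_∈_)
open import Data.List.Membership.Propositional.Properties
  using (∈-++⁺ˡ; ∈-++⁺ʳ; ∈-++⁻; ∈-map⁺; ∈-map⁻; ∈-upTo⁺; ∈-upTo⁻; ∈-lookup)
import Data.List.Membership.Setoid.Properties as SetoidMembership
open import Data.List.Relation.Unary.Any using (here; there; index)
open import Data.List.Relation.Unary.All as All using (All; []; _∷_)
import Data.List.Relation.Unary.All.Properties as AllP
open import Data.List.Relation.Unary.AllPairs as AllPairs using (AllPairs; []; _∷_)
import Data.List.Relation.Unary.AllPairs.Properties as AllPairsP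
open import Data.Product using (_×_; _,_; proj₁; proj₂; Σ)
open import Data.Sum using (inj₁; inj₂)
open import Data.Empty using (⊥; ⊥-elim)
open import Function using (Equivalence; _∘_)
open import Relation.Nullary using (yes; no)
open import Relation.Binary using (tri<; tri≈; tri>)
open import Relation.Binary.PropositionalEquality hiding ([_]; J)

∧-true : ∀ {a b} → a ∧ b ≡ true → a ≡ true × b ≡ true
∧-true {true} {true} _ = refl , refl

true≢false : ∀ {b} → b ≡ true → b ≡ false → ⊥
true≢false refl ()

<ᵇ-true⁻ : ∀ {m n} → (m <ᵇ n) ≡ true → m < n
<ᵇ-true⁻ {m} {n} e = <ᵇ⇒< m n (Equivalence.from T-≡ e)

<ᵇ-true⁺ : ∀ {m n} → m < n → (m <ᵇ n) ≡ true
<ᵇ-true⁺ m<n = Equivalence.to T-≡ (<⇒<ᵇ m<n)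

<ᵇ-false⁺ : ∀ {m n} → n ≤ m → (m <ᵇ n) ≡ false
<ᵇ-false⁺ {m} {n} n≤m with m <ᵇ n in e
... | false = refl
... | true  = ⊥-elim (<⇒≱ (<ᵇ-true⁻ e) n≤m)

≡ᵇ-true⁻ : ∀ {m n} → (m ≡ᵇ n) ≡ true → m ≡ n
≡ᵇ-true⁻ {m} {n} e = ≡ᵇ⇒≡ m n (Equivalence.from T-≡ e)

≡ᵇ-true⁺ : ∀ {m n} → m ≡ n → (m ≡ᵇ n) ≡ true
≡ᵇ-true⁺ {m} {n} e = Equivalence.to T-≡ (≡⇒≡ᵇ m n e)

≡ᵇ-false⁺ : ∀ {m n} → m ≢ n → (m ≡ᵇ n) ≡ false
≡ᵇ-false⁺ {m} {n} m≢n with m ≡ᵇ n in e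
... | false = refl
... | true  = ⊥-elim (m≢n (≡ᵇ-true⁻ e))

nonzeroᵇ⁻ : ∀ x → not (x ≡ᵇ 0) ≡ true → x ≢ 0
nonzeroᵇ⁻ (suc x) _ ()

nonzeroᵇ⁺ : ∀ x → x ≢ 0 → not (x ≡ᵇ 0) ≡ true
nonzeroᵇ⁺ zero    x≢0 = ⊥-elim (x≢0 refl)
nonzeroᵇ⁺ (suc x) _   = refl

boolFilter-∈⁻ : ∀ {A : Set} {p : A → Bool} {x} (xs : List A) → x ∈ boolFilter p xs → x ∈ xs × p x ≡ true
boolFilter-∈⁻ {p = p} (y ∷ xs) x∈ with p y in py
boolFilter-∈⁻ (y ∷ xs) (here refl) | true = here refl , py
boolFilter-∈⁻ (y ∷ xs) (there x∈)  | true = let (m , px) = boolFilter-∈⁻ xs x∈ in there m , px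
boolFilter-∈⁻ (y ∷ xs) x∈          | false = let (m , px) = boolFilter-∈⁻ xs x∈ in there m , px

boolFilter-∈⁺ : ∀ {A : Set} {p : A → Bool} {x} {xs : List A} → x ∈ xs → p x ≡ true → x ∈ boolFilter p xs
boolFilter-∈⁺ {p = p} {xs = y ∷ xs} (here refl) px rewrite px = here refl
boolFilter-∈⁺ {p = p} {xs = y ∷ xs} (there x∈) px with p y
... | true  = there (boolFilter-∈⁺ x∈ px)
... | false = boolFilter-∈⁺ x∈ px

boolFilter-all : ∀ {A : Set} {P : A → Set} {p : A → Bool} {xs : List A} → All P xs → All P (boolFilter p xs)
boolFilter-all {xs = []} [] = []
boolFilter-all {p = p} {xs = y ∷ xs} (py ∷ ps) with p y
... | true  = py ∷ boolFilter-all ps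
... | false = boolFilter-all ps

boolFilter-allPairs : ∀ {A : Set} {R : A → A → Set} {p : A → Bool} {xs : List A} →
  AllPairs R xs → AllPairs R (boolFilter p xs)
boolFilter-allPairs {xs = []} [] = []
boolFilter-allPairs {p = p} {xs = y ∷ xs} (ry ∷ rs) with p y
... | true  = boolFilter-all ry ∷ boolFilter-allPairs rs
... | false = boolFilter-allPairs rs

boolFilter-nonempty : ∀ {A : Set} {p : A → Bool} (xs : List A) →
  length (boolFilter p xs) ≢ 0 → Σ A (λ x → x ∈ xs × p x ≡ true)
boolFilter-nonempty [] len≢0 = ⊥-elim (len≢0 refl)
boolFilter-nonempty {p = p} (y ∷ xs) len≢0 with p y in py
... | true  = y , here refl , py
... | false = let (x , x∈ , px) = boolFilter-nonempty xs len≢0 in x , there x∈ , px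

∈⇒length≢0 : ∀ {A : Set} {x : A} {xs : List A} → x ∈ xs → length xs ≢ 0
∈⇒length≢0 {xs = _ ∷ _} _ ()

boolFilter-none : ∀ {A : Set} {p : A → Bool} (xs : List A) →
  (∀ {x} → x ∈ xs → p x ≡ false) → length (boolFilter p xs) ≡ 0
boolFilter-none [] _ = refl
boolFilter-none {p = p} (y ∷ xs) fails rewrite fails (here refl) = boolFilter-none xs (fails ∘ there)

boolFilter-map : ∀ {A B : Set} (p : B → Bool) (f : A → B) (xs : List A) →
  boolFilter p (map f xs) ≡ map f (boolFilter (λ x → p (f x)) xs)
boolFilter-map p f [] = refl
boolFilter-map p f (x ∷ xs) with p (f x)
... | true  = cong (f x ∷_) (boolFilter-map p f xs)
... | false = boolFilter-map p f xs

boolFilter-cong : ∀ {A : Set} {p q : A → Bool} (xs : List A) →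
  (∀ {x} → x ∈ xs → p x ≡ q x) → boolFilter p xs ≡ boolFilter q xs
boolFilter-cong [] _ = refl
boolFilter-cong {q = q} (x ∷ xs) p≗q rewrite p≗q (here refl) with q x
... | true  = cong (x ∷_) (boolFilter-cong xs (p≗q ∘ there))
... | false = boolFilter-cong xs (p≗q ∘ there)

boolFilter-++ : ∀ {A : Set} (p : A → Bool) (xs ys : List A) →
  boolFilter p (xs ++ ys) ≡ boolFilter p xs ++ boolFilter p ys
boolFilter-++ p [] ys = refl
boolFilter-++ p (x ∷ xs) ys with p x
... | true  = cong (x ∷_) (boolFilter-++ p xs ys)
... | false = boolFilter-++ p xs ys

allᵇ⁻ : ∀ {A : Set} {p : A → Bool} {x} (xs : List A) → allᵇ p xs ≡ true → x ∈ xs → p x ≡ true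
allᵇ⁻ {p = p} (y ∷ xs) all (here refl) = proj₁ (∧-true {p y} all)
allᵇ⁻ {p = p} (y ∷ xs) all (there x∈)  = allᵇ⁻ xs (proj₂ (∧-true {p y} all)) x∈

allᵇ⁺ : ∀ {A : Set} {p : A → Bool} {xs : List A} → All (λ x → p x ≡ true) xs → allᵇ p xs ≡ true
allᵇ⁺ [] = refl
allᵇ⁺ (px ∷ ps) rewrite px = allᵇ⁺ ps

allᵇ-false : ∀ {A : Set} {p : A → Bool} {x} {xs : List A} → x ∈ xs → p x ≡ false → allᵇ p xs ≡ false
allᵇ-false {xs = y ∷ xs} (here refl) px rewrite px = refl
allᵇ-false {p = p} {xs = y ∷ xs} (there x∈) px with p y
... | true  = allᵇ-false x∈ px
... | false = refl

allᵇ-cong : ∀ {A : Set} {p q : A → Bool} (xs : List A) → (∀ {x} → x ∈ xs → p x ≡ q x) → allᵇ p xs ≡ allᵇ q xs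
allᵇ-cong [] _ = refl
allᵇ-cong (x ∷ xs) p≗q = cong₂ _∧_ (p≗q (here refl)) (allᵇ-cong xs (p≗q ∘ there))

allᵇ-map : ∀ {A B : Set} (p : B → Bool) (f : A → B) (xs : List A) → allᵇ p (map f xs) ≡ allᵇ (λ x → p (f x)) xs
allᵇ-map p f [] = refl
allᵇ-map p f (x ∷ xs) = cong (p (f x) ∧_) (allᵇ-map p f xs)

anyᵇ⁺ : ∀ {A : Set} {p : A → Bool} {x} {xs : List A} → x ∈ xs → p x ≡ true → anyᵇ p xs ≡ true
anyᵇ⁺ {xs = y ∷ xs} (here refl) px rewrite px = refl
anyᵇ⁺ {p = p} {xs = y ∷ xs} (there x∈) px with p y
... | true  = refl
... | false = anyᵇ⁺ x∈ px

anyᵇ⁻ : ∀ {A : Set} {p : A → Bool} (xs : List A) → anyᵇ p xs ≡ true → Σ A (λ x → x ∈ xs × p x ≡ true)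
anyᵇ⁻ {p = p} (y ∷ xs) any with p y in py
... | true  = y , here refl , py
... | false = let (x , x∈ , px) = anyᵇ⁻ xs any in x , there x∈ , px

elemᵇ-false : ∀ {x} (ys : List ℕ) → All (x ≢_) ys → elemᵇ x ys ≡ false
elemᵇ-false [] [] = refl
elemᵇ-false (y ∷ ys) (x≢y ∷ rest) rewrite ≡ᵇ-false⁺ x≢y = elemᵇ-false ys rest

distinctᵇ⁺ : ∀ (xs : List ℕ) → AllPairs _≢_ xs → distinctᵇ xs ≡ true
distinctᵇ⁺ [] [] = refl
distinctᵇ⁺ (x ∷ xs) (x∉ ∷ rest) rewrite elemᵇ-false xs x∉ = distinctᵇ⁺ xs rest

nth-map : ∀ (f : ℕ → ℕ) (xs : List ℕ) i → i < length xs → nth (map f xs) i ≡ f (nth xs i)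
nth-map f (x ∷ xs) zero    _         = refl
nth-map f (x ∷ xs) (suc i) (s≤s i<n) = nth-map f xs i i<n

nth-++ˡ : ∀ (xs ys : List ℕ) i → i < length xs → nth (xs ++ ys) i ≡ nth xs i
nth-++ˡ (x ∷ xs) ys zero    _         = refl
nth-++ˡ (x ∷ xs) ys (suc i) (s≤s i<n) = nth-++ˡ xs ys i i<n

nth-last : ∀ (xs : List ℕ) y → nth (xs ++ [ y ]) (length xs) ≡ y
nth-last []       y = refl
nth-last (x ∷ xs) y = nth-last xs y

nth-∈ : ∀ (xs : List ℕ) i → i < length xs → nth xs i ∈ xs
nth-∈ (x ∷ xs) zero    _         = here refl
nth-∈ (x ∷ xs) (suc i) (s≤s i<n) = there (nth-∈ xs i i<n)

∈-nth : ∀ {x} (xs : List ℕ) → x ∈ xs → Σ ℕ (λ i → i < length xs × nth xs i ≡ x)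
∈-nth (y ∷ xs) (here refl) = 0 , s≤s z≤n , refl
∈-nth (y ∷ xs) (there x∈)  = let (i , i<n , e) = ∈-nth xs x∈ in suc i , s≤s i<n , e

nth-allPairs : ∀ {R : ℕ → ℕ → Set} (xs : List ℕ) → AllPairs R xs →
  ∀ i j → i < j → j < length xs → R (nth xs i) (nth xs j)
nth-allPairs (x ∷ xs) (rx ∷ _)  zero    (suc j) _         (s≤s j<n) = All.lookup rx (nth-∈ xs j j<n)
nth-allPairs (x ∷ xs) (_ ∷ rs) (suc i) (suc j) (s≤s i<j) (s≤s j<n) = nth-allPairs xs rs i j i<j j<n

length-snoc : ∀ (xs : List ℕ) y → length (xs ++ [ y ]) ≡ suc (length xs)
length-snoc xs y = trans (length-++ xs) (+-comm (length xs) 1)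

allPairs-mapWith : ∀ {A : Set} {R R′ : A → A → Set} {P : A → Set} {xs : List A} →
  (∀ {z w} → P z → P w → R z w → R′ z w) → All P xs → AllPairs R xs → AllPairs R′ xs
allPairs-mapWith f [] [] = []
allPairs-mapWith f (pz ∷ ps) (r ∷ rs) = All.zipWith (λ (pw , rw) → f pz pw rw) (ps , r) ∷ allPairs-mapWith f ps rs

concatMap-∈⁻ : ∀ {A B : Set} (g : A → List B) (xs : List A) {y} → y ∈ concatMap g xs → Σ A (λ x → x ∈ xs × y ∈ g x)
concatMap-∈⁻ g (x ∷ xs) y∈ with ∈-++⁻ (g x) y∈
... | inj₁ y∈gx = x , here refl , y∈gx
... | inj₂ y∈rest = let (z , z∈ , y∈gz) = concatMap-∈⁻ g xs y∈rest in z , there z∈ , y∈gz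

concatMap-∈⁺ : ∀ {A B : Set} (g : A → List B) {xs : List A} {x y} → x ∈ xs → y ∈ g x → y ∈ concatMap g xs
concatMap-∈⁺ g (here refl) y∈ = ∈-++⁺ˡ y∈
concatMap-∈⁺ g {z ∷ _} (there x∈) y∈ = ∈-++⁺ʳ (g z) (concatMap-∈⁺ g x∈ y∈)

concatMap-allPairs : ∀ {A B : Set} {R′ : A → A → Set} {R : B → B → Set} (g : A → List B) (xs : List A) →
  AllPairs R′ xs → (∀ {x} → x ∈ xs → AllPairs R (g x)) →
  (∀ {x y u v} → R′ x y → u ∈ g x → v ∈ g y → R u v) → AllPairs R (concatMap g xs)
concatMap-allPairs g [] [] _ _ = []
concatMap-allPairs g (x ∷ xs) (rx ∷ rs) within across =
  AllPairsP.++⁺ (within (here refl)) (concatMap-allPairs g xs rs (within ∘ there) across)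
    (All.tabulate (λ u∈ → All.tabulate (λ v∈ →
       let (y , y∈ , v∈gy) = concatMap-∈⁻ g xs v∈ in across (All.lookup rx y∈) u∈ v∈gy)))

upTo-sorted : ∀ n → AllPairs _<_ (upTo n)
upTo-sorted n = AllPairsP.applyUpTo⁺₁ (λ x → x) n (λ i<j _ → i<j)

allLists-complete : ∀ l m (xs : List ℕ) → length xs ≡ l → All (_< m) xs → xs ∈ allLists l m
allLists-complete zero    m []       refl []           = here refl
allLists-complete (suc l) m (x ∷ xs) refl (x<m ∷ rest) =
  concatMap-∈⁺ (λ x → map (x ∷_) (allLists l m)) (∈-upTo⁺ x<m) (∈-map⁺ (x ∷_) (allLists-complete l m xs refl rest))

images-separate : ∀ {A B : Set} (f : A → B) {xs : List A} → AllPairs (λ x y → f x ≢ f y) xs →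
  ∀ i j → f (lookup xs i) ≡ f (lookup xs j) → i ≡ j
images-separate f (_ ∷ _)    fzero    fzero    _ = refl
images-separate f (fx≢ ∷ _) fzero    (fsuc j) e = ⊥-elim (All.lookup fx≢ (∈-lookup j) e)
images-separate f (fx≢ ∷ _) (fsuc i) fzero    e = ⊥-elim (All.lookup fx≢ (∈-lookup i) (sym e))
images-separate f (_ ∷ d)    (fsuc i) (fsuc j) e = cong fsuc (images-separate f d i j e)

distinct-images-length : ∀ {A B : Set} (f : A → B) {xs : List A} {ys : List B} →
  AllPairs (λ x y → f x ≢ f y) xs → All (λ x → f x ∈ ys) xs → length xs ≤ length ys
distinct-images-length {B = B} f {xs} distinct into = injective⇒≤ position-injective
  where
  position : Fin (length xs) → Fin _
  position i = index (All.lookup into (∈-lookup i))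
  position-injective : ∀ {i j} → position i ≡ position j → i ≡ j
  position-injective {i} {j} e = images-separate f distinct i j
    (SetoidMembership.index-injective (setoid B) (All.lookup into (∈-lookup i)) (All.lookup into (∈-lookup j)) e)

distinct-images-below : ∀ {A : Set} (g : A → ℕ) {xs : List A} {N : ℕ} →
  AllPairs (λ x y → g x ≢ g y) xs → All (λ x → g x < N) xs → length xs ≤ N
distinct-images-below g {N = N} distinct bounded =
  subst (_ ≤_) (length-upTo N) (distinct-images-length g distinct (All.map ∈-upTo⁺ bounded))

-- The staircase encoding of Defs, with its private abbreviations made public.

ks : List ℕ → List ℕ
ks = lrMinPositions

K : List ℕ → ℕ → ℕ
K π j = nth (ks π ++ [ length π ]) (j ∸ 1)

V : List ℕ → ℕ → ℕ
V π i = nth (length π ∷ map (nth π) (ks π)) i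

inBoxᵇ : List ℕ → ℕ → ℕ → ℕ → Bool
inBoxᵇ π i j p = (K π j <ᵇ p) ∧ ((p <ᵇ K π (suc j)) ∧ ((V π i <ᵇ nth π p) ∧ (nth π p <ᵇ V π (i ∸ 1))))

record InBox (π : List ℕ) (i j p : ℕ) : Set where
  field
    p<n    : p < length π
    after  : K π j < p
    before : p < K π (suc j)
    above  : V π i < nth π p
    below  : nth π p < V π (i ∸ 1)

inBox⁻ : ∀ π i j p → p < length π → inBoxᵇ π i j p ≡ true → InBox π i j p
inBox⁻ π i j p p<n t =
  let (t₁ , r₁) = ∧-true {K π j <ᵇ p} t
      (t₂ , r₂) = ∧-true {p <ᵇ K π (suc j)} r₁
      (t₃ , t₄) = ∧-true {V π i <ᵇ nth π p} r₂
  in record { p<n = p<n ; after = <ᵇ-true⁻ t₁ ; before = <ᵇ-true⁻ t₂ ; above = <ᵇ-true⁻ t₃ ; below = <ᵇ-true⁻ t₄ }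

inBox⁺ : ∀ {π i j p} → InBox π i j p → inBoxᵇ π i j p ≡ true
inBox⁺ w rewrite <ᵇ-true⁺ (InBox.after w) | <ᵇ-true⁺ (InBox.before w)
               | <ᵇ-true⁺ (InBox.above w) | <ᵇ-true⁺ (InBox.below w) = refl

ks-sorted : ∀ π → AllPairs _<_ (ks π)
ks-sorted π = boolFilter-allPairs (upTo-sorted (length π))

ks-∈ : ∀ π {x} → x ∈ ks π → x < length π × isLRminᵇ π x ≡ true
ks-∈ π x∈ = let (x∈upTo , isMin) = boolFilter-∈⁻ (upTo (length π)) x∈ in ∈-upTo⁻ x∈upTo , isMin

ks-bounded : ∀ π → All (_< length π) (ks π)
ks-bounded π = All.tabulate (λ x∈ → proj₁ (ks-∈ π x∈))

ks-minimal : ∀ π {x y} → x ∈ ks π → y < x → nth π x < nth π y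
ks-minimal π {x} x∈ y<x = <ᵇ-true⁻ (allᵇ⁻ (upTo x) (proj₂ (ks-∈ π x∈)) (∈-upTo⁺ y<x))

K-list-sorted : ∀ π → AllPairs _<_ (ks π ++ [ length π ])
K-list-sorted π = AllPairsP.++⁺ (ks-sorted π) ([] ∷ []) (All.map (_∷ []) (ks-bounded π))

K-strict : ∀ π j j′ → j < j′ → j′ ≤ length (ks π) → K π (suc j) < K π (suc j′)
K-strict π j j′ j<j′ j′≤a =
  nth-allPairs _ (K-list-sorted π) j j′ j<j′ (subst (j′ <_) (sym (length-snoc (ks π) _)) (s≤s j′≤a))

K-mono : ∀ π j j′ → j ≤ j′ → j′ ≤ length (ks π) → K π (suc j) ≤ K π (suc j′)
K-mono π j j′ j≤j′ j′≤a with m≤n⇒m<n∨m≡n j≤j′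
... | inj₁ j<j′ = <⇒≤ (K-strict π j j′ j<j′ j′≤a)
... | inj₂ refl = ≤-refl

K-reflect : ∀ π j j′ → j ≤ length (ks π) → K π (suc j) < K π (suc j′) → j < j′
K-reflect π j j′ j≤a K< with j <? j′
... | yes j<j′ = j<j′
... | no  j≮j′ = ⊥-elim (<⇒≱ K< (K-mono π j′ j (≮⇒≥ j≮j′) j≤a))

value-at-K : ∀ π i → i < length (ks π) → nth π (K π (suc i)) ≡ V π (suc i)
value-at-K π i i<a =
  trans (cong (nth π) (nth-++ˡ (ks π) [ length π ] i i<a)) (sym (nth-map (nth π) (ks π) i i<a))

V-antitone : ∀ π i i′ → i ≤ i′ → i′ < length (ks π) → V π (suc i′) ≤ V π (suc i)
V-antitone π i i′ i≤i′ i′<a with m≤n⇒m<n∨m≡n i≤i′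
... | inj₂ refl = ≤-refl
... | inj₁ i<i′ = <⇒≤ (subst₂ _<_ (value-at-K′ i′ i′<a) (value-at-K′ i i<a)
                        (ks-minimal π (nth-∈ (ks π) i′ i′<a) (nth-allPairs (ks π) (ks-sorted π) i i′ i<i′ i′<a)))
  where
  i<a = <-trans i<i′ i′<a
  value-at-K′ : ∀ m → m < length (ks π) → nth π (nth (ks π) m) ≡ V π (suc m)
  value-at-K′ m m<a = trans (cong (nth π) (sym (nth-++ˡ (ks π) _ m m<a))) (value-at-K π m m<a)

column : ℕ → List (ℕ × ℕ)
column j = concatMap (λ i → [ (suc i , suc j) ]) (upTo (suc j))

boxes-∈⁻ : ∀ π {b} → b ∈ boxes π → Σ ℕ (λ i → Σ ℕ (λ j → b ≡ (suc i , suc j) × i ≤ j × j < length (ks π)))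
boxes-∈⁻ π b∈ =
  let (j , j∈ , b∈col) = concatMap-∈⁻ column (upTo (length (ks π))) b∈
      (i , i∈ , b∈[]) = concatMap-∈⁻ (λ i → [ (suc i , suc j) ]) (upTo (suc j)) b∈col
  in i , j , singleton b∈[] , ≤-pred (∈-upTo⁻ i∈) , ∈-upTo⁻ j∈
  where
  singleton : ∀ {b x} → b ∈ [ x ] → b ≡ x
  singleton (here e) = e

boxes-∈⁺ : ∀ π {i j} → i ≤ j → j < length (ks π) → (suc i , suc j) ∈ boxes π
boxes-∈⁺ π {i} {j} i≤j j<a =
  concatMap-∈⁺ column (∈-upTo⁺ j<a) (concatMap-∈⁺ (λ i → [ (suc i , suc j) ]) (∈-upTo⁺ (s≤s i≤j)) (here refl))

boxes-distinct : ∀ π → AllPairs _≢_ (boxes π)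
boxes-distinct π = concatMap-allPairs column (upTo (length (ks π))) (upTo-sorted _)
  (λ {j} _ → concatMap-allPairs (λ i → [ (suc i , suc j) ]) (upTo (suc j)) (upTo-sorted _) (λ _ → [] ∷ [])
      (λ { i<i′ (here refl) (here refl) e → <⇒≢ i<i′ (suc-injective (cong proj₁ e)) }))
  (λ {j} {j′} j<j′ u∈ v∈ →
     let (_ , _ , u∈[]) = concatMap-∈⁻ (λ i → [ (suc i , suc j) ]) (upTo (suc j)) u∈
         (_ , _ , v∈[]) = concatMap-∈⁻ (λ i → [ (suc i , suc j′) ]) (upTo (suc j′)) v∈
     in columns-apart j<j′ u∈[] v∈[])
  where
  columns-apart : ∀ {j j′ i i′ u v} → j < j′ → u ∈ [ (suc i , suc j) ] → v ∈ [ (suc i′ , suc j′) ] → u ≢ v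
  columns-apart j<j′ (here refl) (here refl) e = <⇒≢ j<j′ (suc-injective (cong proj₂ e))

record Box (π : List ℕ) (i j : ℕ) : Set where
  field
    row≥1  : 1 ≤ i
    row≤col : i ≤ j
    col≤a  : j ≤ length (ks π)

col≥1 : ∀ {π i j} → Box π i j → 1 ≤ j
col≥1 b = ≤-trans (Box.row≥1 b) (Box.row≤col b)

NonzeroBox : List ℕ → ℕ → ℕ → Set
NonzeroBox π i j = Box π i j × Σ ℕ (InBox π i j)

nonzeroList : List ℕ → List (ℕ × ℕ)
nonzeroList π = boolFilter (λ b → not (boxEntry π (proj₁ b) (proj₂ b) ≡ᵇ 0)) (boxes π)

firstSatisfying : (ℕ → Bool) → List ℕ → ℕ
firstSatisfying q []       = 0
firstSatisfying q (x ∷ xs) = if q x then x else firstSatisfying q xs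

firstSatisfying-ok : ∀ q (xs : List ℕ) {x} → x ∈ xs → q x ≡ true →
  firstSatisfying q xs ∈ xs × q (firstSatisfying q xs) ≡ true
firstSatisfying-ok q (y ∷ xs) x∈ qx with q y in qy
... | true = here refl , qy
firstSatisfying-ok q (y ∷ xs) (here refl) qx | false = ⊥-elim (true≢false qx qy)
firstSatisfying-ok q (y ∷ xs) (there x∈)  qx | false =
  let (f∈ , qf) = firstSatisfying-ok q xs x∈ qx in there f∈ , qf

witness : List ℕ → ℕ × ℕ → ℕ
witness π (i , j) = firstSatisfying (inBoxᵇ π i j) (upTo (length π))

nonzero⁻ : ∀ π {i j} → (i , j) ∈ nonzeroList π → Box π i j × InBox π i j (witness π (i , j))
nonzero⁻ π {i} {j} b∈ =
  let (b∈boxes , nonzero) = boolFilter-∈⁻ (boxes π) b∈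
      (i′ , j′ , b≡ , i′≤j′ , j′<a) = boxes-∈⁻ π b∈boxes
      (p , p∈ , inBox) = boolFilter-nonempty (upTo (length π)) (nonzeroᵇ⁻ (boxEntry π i j) nonzero)
      (w∈ , inBoxʷ) = firstSatisfying-ok (inBoxᵇ π i j) (upTo (length π)) p∈ inBox
  in box b≡ i′≤j′ j′<a , inBox⁻ π i j _ (∈-upTo⁻ w∈) inBoxʷ
  where
  box : ∀ {i′ j′} → (i , j) ≡ (suc i′ , suc j′) → i′ ≤ j′ → j′ < length (ks π) → Box π i j
  box refl i′≤j′ j′<a = record { row≥1 = s≤s z≤n ; row≤col = s≤s i′≤j′ ; col≤a = j′<a }

nonzero⁺ : ∀ π {i j} → NonzeroBox π i j → (i , j) ∈ nonzeroList π
nonzero⁺ π {suc i} {suc j} (b , p , w) =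
  boolFilter-∈⁺ (boxes-∈⁺ π (≤-pred (Box.row≤col b)) (Box.col≤a b))
    (nonzeroᵇ⁺ (boxEntry π (suc i) (suc j)) (∈⇒length≢0 (boolFilter-∈⁺ (∈-upTo⁺ (InBox.p<n w)) (inBox⁺ w))))

nonzeroList-distinct : ∀ π → AllPairs _≢_ (nonzeroList π)
nonzeroList-distinct π = boolFilter-allPairs (boxes-distinct π)


record Pattern132 (π : List ℕ) (p q r : ℕ) : Set where
  field
    p<q : p < q
    q<r : q < r
    r<n : r < length π
    πp<πr : nth π p < nth π r
    πr<πq : nth π r < nth π q

pattern⇒contains : ∀ π {p q r} → Pattern132 π p q r → contains132ᵇ π ≡ true
pattern⇒contains π {p} {q} {r} o =
  anyᵇ⁺ (∈-upTo⁺ r<n) (anyᵇ⁺ (∈-upTo⁺ q<n) (anyᵇ⁺ (∈-upTo⁺ (<-trans p<q q<n))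
    (cong₂ _∧_ (<ᵇ-true⁺ p<q) (cong₂ _∧_ (<ᵇ-true⁺ q<r) (cong₂ _∧_ (<ᵇ-true⁺ πp<πr) (<ᵇ-true⁺ πr<πq))))))
  where
  open Pattern132 o
  q<n = <-trans q<r r<n

contains⇒pattern : ∀ π → contains132ᵇ π ≡ true → Σ ℕ (λ p → Σ ℕ (λ q → Σ ℕ (λ r → Pattern132 π p q r)))
contains⇒pattern π c =
  let (r , r∈ , c₁) = anyᵇ⁻ (upTo (length π)) c
      (q , _  , c₂) = anyᵇ⁻ (upTo (length π)) c₁
      (p , _  , c₃) = anyᵇ⁻ (upTo (length π)) c₂
      (t₁ , r₁) = ∧-true {p <ᵇ q} c₃
      (t₂ , r₂) = ∧-true {q <ᵇ r} r₁
      (t₃ , t₄) = ∧-true {nth π p <ᵇ nth π r} r₂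
  in p , q , r , record { p<q = <ᵇ-true⁻ t₁ ; q<r = <ᵇ-true⁻ t₂ ; r<n = ∈-upTo⁻ r∈
                        ; πp<πr = <ᵇ-true⁻ t₃ ; πr<πq = <ᵇ-true⁻ t₄ }

pattern-end≥2 : ∀ {π p q r} → Pattern132 π p q r → 2 ≤ r
pattern-end≥2 o = ≤-trans (s≤s (≤-trans (s≤s z≤n) (Pattern132.p<q o))) (Pattern132.q<r o)

avoidance-transfer : ∀ π π′ → (∀ {p q r} → Pattern132 π′ p q r → Σ ℕ (λ p → Σ ℕ (λ q → Σ ℕ (λ r → Pattern132 π p q r)))) →
  contains132ᵇ π ≡ false → contains132ᵇ π′ ≡ false
avoidance-transfer π π′ reflect avoids with contains132ᵇ π′ in c
... | false = refl
... | true  = let (_ , _ , _ , o′) = contains⇒pattern π′ c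
                  (_ , _ , _ , o) = reflect o′
              in ⊥-elim (true≢false (pattern⇒contains π o) avoids)

-- A position counted in a
-- box determines the box, and is not an LR-minimum position; so the witnesses
-- of the nonzero boxes and the LR-minimum positions are distinct positions.

same-column : ∀ π {i j i′ j′ p} → Box π i j → Box π i′ j′ → InBox π i j p → InBox π i′ j′ p → j < j′ → ⊥
same-column π {i = suc _} {j = suc j₀} {j′ = suc j₀′} b b′ w w′ (s≤s j₀<j₀′) =
  <-irrefl refl (<-≤-trans (InBox.before w) (≤-trans (K-mono π (suc j₀) j₀′ j₀<j₀′ (<⇒≤ (Box.col≤a b′))) (<⇒≤ (InBox.after w′))))

same-row : ∀ π {i j i′ p} → Box π i j → Box π i′ j → InBox π i j p → InBox π i′ j p → i < i′ → ⊥
same-row π {i = suc i₀} {i′ = suc (suc i₀′)} b b′ w w′ (s≤s (s≤s i₀≤i₀′)) =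
  <-irrefl refl (<-≤-trans (InBox.above w) (≤-trans (<⇒≤ (InBox.below w′))
    (V-antitone π i₀ i₀′ i₀≤i₀′ (≤-trans (n≤1+n _) (≤-trans (Box.row≤col b′) (Box.col≤a b′))))))

box-determined : ∀ π {i j i′ j′ p} → Box π i j → Box π i′ j′ → InBox π i j p → InBox π i′ j′ p → (i , j) ≡ (i′ , j′)
box-determined π {i} {j} {i′} {j′} b b′ w w′ with <-cmp j j′
... | tri< j<j′ _ _ = ⊥-elim (same-column π b b′ w w′ j<j′)
... | tri> _ _ j>j′ = ⊥-elim (same-column π b′ b w′ w j>j′)
... | tri≈ _ refl _ with <-cmp i i′
... | tri< i<i′ _ _ = ⊥-elim (same-row π b b′ w w′ i<i′)
... | tri> _ _ i>i′ = ⊥-elim (same-row π b′ b w′ w i>i′)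
... | tri≈ _ refl _ = refl

witness-injective : ∀ π {b b′} → b ∈ nonzeroList π → b′ ∈ nonzeroList π → witness π b ≡ witness π b′ → b ≡ b′
witness-injective π {i , j} {i′ , j′} b∈ b′∈ e =
  let (b , w) = nonzero⁻ π b∈
      (b′ , w′) = nonzero⁻ π b′∈
  in box-determined π b b′ w (subst (InBox π i′ j′) (sym e) w′)

-- A position counted in box (i , j) lies strictly between k_j and k_{j+1}.
inBox-not-min : ∀ π {i j p m} → Box π i j → InBox π i j p → m < length (ks π) → nth (ks π) m ≢ p
inBox-not-min π {i = suc _} {j = suc j₀} {p} {m} b w m<a e =
  <⇒≱ (K-reflect π j₀ m (<⇒≤ (Box.col≤a b)) (subst (K π (suc j₀) <_) (sym k≡p) (InBox.after w)))
      (≤-pred (K-reflect π m (suc j₀) (<⇒≤ m<a) (subst (_< K π (suc (suc j₀))) (sym k≡p) (InBox.before w))))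
  where
  k≡p : K π (suc m) ≡ p
  k≡p = trans (nth-++ˡ (ks π) [ length π ] m m<a) e

bound-by-length : ∀ π → length (nonzeroList π) + length (ks π) ≤ length π
bound-by-length π = subst (_≤ length π) length-positions (distinct-images-below (λ x → x) distinct bounded)
  where
  positions = map (witness π) (nonzeroList π) ++ ks π
  length-positions : length positions ≡ length (nonzeroList π) + length (ks π)
  length-positions = trans (length-++ (map (witness π) (nonzeroList π))) (cong (_+ length (ks π)) (length-map (witness π) (nonzeroList π)))
  witness∉ks : ∀ {x y} → x ∈ map (witness π) (nonzeroList π) → y ∈ ks π → x ≢ y
  witness∉ks x∈ y∈ x≡y =
    let (b , b∈ , x≡) = ∈-map⁻ (witness π) x∈
        (m , m<a , y≡) = ∈-nth (ks π) y∈
        (box , w) = nonzero⁻ π {proj₁ b} {proj₂ b} b∈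
    in inBox-not-min π box w m<a (trans y≡ (trans (sym x≡y) x≡))
  distinct : AllPairs _≢_ positions
  distinct = AllPairsP.++⁺
    (AllPairsP.map⁺ (allPairs-mapWith (λ b∈ b′∈ b≢b′ e → b≢b′ (witness-injective π b∈ b′∈ e))
                                      (All.tabulate (λ b∈ → b∈)) (nonzeroList-distinct π)))
    (AllPairs.map <⇒≢ (ks-sorted π))
    (All.tabulate (λ x∈ → All.tabulate (λ y∈ → witness∉ks x∈ y∈)))
  bounded : All (_< length π) positions
  bounded = AllP.++⁺
    (All.tabulate (λ x∈ → let (b , b∈ , x≡) = ∈-map⁻ (witness π) x∈
                          in subst (_< length π) (sym x≡) (InBox.p<n (proj₂ (nonzero⁻ π {proj₁ b} {proj₂ b} b∈)))))
    (ks-bounded π)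


-- Second bound, for 132-avoiders: (number of nonzero boxes) ≤ 2a − 1.
-- Call a nonzero box covered if a nonzero box lies above it in its column.
-- Uncovered boxes are topmost in their columns, so there are at most a of
-- them; covered boxes lie in rows 2 … a, and a row holds at most one of them.

-- Nonzero boxes (i , j) and (r , j′) with i < r ≤ j < j′ force a 132:
-- the entry at k_j, the entry counted in (i , j), the entry counted in (r , j′).
row-conflict : ∀ π {i j r j′ q s} → Box π i j → InBox π i j q → r ≤ j → Box π r j′ → InBox π r j′ s →
  i < r → j < j′ → contains132ᵇ π ≡ true
row-conflict π {suc i₀} {suc j₀} {suc (suc r₁)} {suc j₀′} {q} {s} b w r≤j b′ w′ (s≤s (s≤s i₀≤r₁)) (s≤s j₀<j₀′) =
  pattern⇒contains π {K π (suc j₀)} {q} {s} record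
    { p<q   = InBox.after w
    ; q<r   = <-≤-trans (InBox.before w) (≤-trans (K-mono π (suc j₀) j₀′ j₀<j₀′ (<⇒≤ (Box.col≤a b′))) (<⇒≤ (InBox.after w′)))
    ; r<n   = InBox.p<n w′
    ; πp<πr = subst (_< nth π s) (sym (value-at-K π j₀ j₀<a))
                (≤-<-trans (V-antitone π (suc r₁) j₀ (≤-pred r≤j) j₀<a) (InBox.above w′))
    ; πr<πq = <-≤-trans (InBox.below w′) (≤-trans (V-antitone π i₀ r₁ i₀≤r₁ r₁<a) (<⇒≤ (InBox.above w)))
    }
  where
  j₀<a = Box.col≤a b
  r₁<a : r₁ < length (ks π)
  r₁<a = ≤-trans (n≤1+n _) (≤-trans r≤j j₀<a)

coveredᵇ : List ℕ → ℕ × ℕ → Bool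
coveredᵇ π (i , j) = anyᵇ (λ b → (proj₂ b ≡ᵇ j) ∧ (proj₁ b <ᵇ i)) (nonzeroList π)

covered⁻ : ∀ π {i j} → coveredᵇ π (i , j) ≡ true → Σ ℕ (λ i₀ → (i₀ , j) ∈ nonzeroList π × i₀ < i)
covered⁻ π {i} {j} c with anyᵇ⁻ (nonzeroList π) c
... | (i₀ , j₀) , b∈ , t = let (t₁ , t₂) = ∧-true {j₀ ≡ᵇ j} t
                           in i₀ , subst (λ z → (i₀ , z) ∈ nonzeroList π) (≡ᵇ-true⁻ t₁) b∈ , <ᵇ-true⁻ t₂

covered⁺ : ∀ π {i j i′} → (i , j) ∈ nonzeroList π → i < i′ → coveredᵇ π (i′ , j) ≡ true
covered⁺ π {i} {j} b∈ i<i′ = anyᵇ⁺ b∈ (cong₂ _∧_ (≡ᵇ-true⁺ {j} refl) (<ᵇ-true⁺ i<i′))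

covered-row : ∀ π {i j} → coveredᵇ π (i , j) ≡ true → Σ ℕ (λ i₂ → i ≡ suc (suc i₂))
covered-row π c with covered⁻ π c
... | _ , b∈ , i₀<i = two≤ (≤-trans (s≤s (Box.row≥1 (proj₁ (nonzero⁻ π b∈)))) i₀<i)
  where
  two≤ : ∀ {i} → 2 ≤ i → Σ ℕ (λ i₂ → i ≡ suc (suc i₂))
  two≤ (s≤s (s≤s {n = i₂} _)) = i₂ , refl

covered-rightmost : ∀ π → contains132ᵇ π ≡ false → ∀ {i j j′} → coveredᵇ π (i , j) ≡ true →
  (i , j) ∈ nonzeroList π → (i , j′) ∈ nonzeroList π → j < j′ → ⊥
covered-rightmost π avoids c b∈ b′∈ j<j′ =
  let (i₀ , cover∈ , i₀<i) = covered⁻ π c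
      (cover , w) = nonzero⁻ π cover∈
      (b , _) = nonzero⁻ π b∈
      (b′ , w′) = nonzero⁻ π b′∈
  in true≢false (row-conflict π cover w (Box.row≤col b) b′ w′ i₀<i j<j′) avoids

code : List ℕ → ℕ × ℕ → ℕ
code π (i , j) = if coveredᵇ π (i , j) then (i ∸ 2) + length (ks π) else j ∸ 1

code-bound : ∀ π {b} → b ∈ nonzeroList π → code π b < pred (length (ks π)) + length (ks π)
code-bound π {i , j} b∈ with coveredᵇ π (i , j) in c
... | true with covered-row π {i} {j} c
...   | _ , refl = +-monoˡ-< (length (ks π)) (<⇒≤pred (≤-trans (Box.row≤col b) (Box.col≤a b)))
  where b = proj₁ (nonzero⁻ π b∈)
code-bound π {i , j} b∈ | false = ≤-trans (column-code-bound (proj₁ (nonzero⁻ π b∈))) (m≤n+m _ _)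
  where
  column-code-bound : ∀ {i j} → Box π i j → j ∸ 1 < length (ks π)
  column-code-bound {suc _} {suc _} b = Box.col≤a b

∸1-injective : ∀ {j j′} → 1 ≤ j → 1 ≤ j′ → j ∸ 1 ≡ j′ ∸ 1 → j ≡ j′
∸1-injective {suc _} {suc _} _ _ e = cong suc e

-- Row codes of covered boxes are at least a, column codes are below a.
row-code≢column-code : ∀ π {i i′ j′} → Σ ℕ (λ i₂ → i ≡ suc (suc i₂)) → Box π i′ j′ → (i ∸ 2) + length (ks π) ≢ j′ ∸ 1
row-code≢column-code π {i′ = suc _} {j′ = suc _} (i₂ , refl) b′ e = <⇒≱ (Box.col≤a b′) (subst (length (ks π) ≤_) e (m≤n+m _ i₂))

code-injective : ∀ π → contains132ᵇ π ≡ false → ∀ {b b′} → b ∈ nonzeroList π → b′ ∈ nonzeroList π →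
  code π b ≡ code π b′ → b ≡ b′
code-injective π avoids {i , j} {i′ , j′} b∈ b′∈ e with coveredᵇ π (i , j) in c | coveredᵇ π (i′ , j′) in c′
... | true | true with covered-row π {i} {j} c | covered-row π {i′} {j′} c′
...   | i₂ , refl | i₂′ , refl with +-cancelʳ-≡ (length (ks π)) i₂ i₂′ e
...     | refl with <-cmp j j′
...       | tri≈ _ refl _ = refl
...       | tri< j<j′ _ _ = ⊥-elim (covered-rightmost π avoids c b∈ b′∈ j<j′)
...       | tri> _ _ j>j′ = ⊥-elim (covered-rightmost π avoids c′ b′∈ b∈ j>j′)
code-injective π avoids {i , j} {i′ , j′} b∈ b′∈ e | false | false
  with ∸1-injective (col≥1 (proj₁ (nonzero⁻ π b∈))) (col≥1 (proj₁ (nonzero⁻ π b′∈))) e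
... | refl with <-cmp i i′
...   | tri≈ _ refl _ = refl
...   | tri< i<i′ _ _ = ⊥-elim (true≢false (covered⁺ π b∈ i<i′) c′)
...   | tri> _ _ i>i′ = ⊥-elim (true≢false (covered⁺ π b′∈ i>i′) c)
code-injective π avoids {i , j} {i′ , j′} b∈ b′∈ e | true | false =
  ⊥-elim (row-code≢column-code π (covered-row π {i} {j} c) (proj₁ (nonzero⁻ π b′∈)) e)
code-injective π avoids {i , j} {i′ , j′} b∈ b′∈ e | false | true =
  ⊥-elim (row-code≢column-code π (covered-row π {i′} {j′} c′) (proj₁ (nonzero⁻ π b∈)) (sym e))

bound-by-minima : ∀ π → contains132ᵇ π ≡ false → length (nonzeroList π) ≤ pred (length (ks π)) + length (ks π)
bound-by-minima π avoids = distinct-images-below (code π)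
  (allPairs-mapWith (λ b∈ b′∈ b≢b′ e → b≢b′ (code-injective π avoids b∈ b′∈ e)) (All.tabulate (λ b∈ → b∈)) (nonzeroList-distinct π))
  (All.tabulate (code-bound π))

three-k-bound : ∀ k a n → k + a ≤ n → k ≤ pred a + a → k * 3 ≤ 2 * n ∸ 1
three-k-bound k zero n _ z≤n = z≤n
three-k-bound k (suc a) n k+a≤n k≤2a-1 = begin
  k * 3                   ≡⟨ triple k ⟩
  (k + k) + k             ≤⟨ +-monoʳ-≤ (k + k) k≤2a-1 ⟩
  (k + k) + (a + suc a)   ≡⟨ cong (_∸ 1) (sym (double-sum k a)) ⟩
  2 * (k + suc a) ∸ 1     ≤⟨ ∸-monoˡ-≤ 1 (*-monoʳ-≤ 2 k+a≤n) ⟩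
  2 * n ∸ 1               ∎
  where
  open ≤-Reasoning
  double-sum : ∀ k a → 2 * (k + suc a) ≡ suc ((k + k) + (a + suc a))
  double-sum = solve-∀
  triple : ∀ k → k * 3 ≡ (k + k) + k
  triple = solve-∀

upper-bound : ∀ π → contains132ᵇ π ≡ false → nonzeroBoxes π ≤ (2 * length π ∸ 1) / 3
upper-bound π avoids = ≤-trans (≤-reflexive (sym (m*n/n≡m (nonzeroBoxes π) 3)))
  (/-monoˡ-≤ 3 (three-k-bound (nonzeroBoxes π) (length (ks π)) (length π) (bound-by-length π) (bound-by-minima π avoids)))


-- The new LR minima are position 0 and the old ones shifted by two, so every
-- nonzero box (i , j) of π reappears as (i+1 , j+1), and the entry n+1 fills
-- the new box (1 , 1).

shift₂ : ℕ → ℕ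
shift₂ x = suc (suc x)

module Prepend (π : List ℕ) (bounded : All (_< length π) π) where
  n : ℕ
  n = length π

  π′ : List ℕ
  π′ = n ∷ suc n ∷ π

  entry<n : ∀ p → p < n → nth π p < n
  entry<n p p<n = All.lookup bounded (nth-∈ π p p<n)

  isLRmin-shift : ∀ p → p < n → isLRminᵇ π′ (shift₂ p) ≡ isLRminᵇ π p
  isLRmin-shift p p<n = begin
    isLRminᵇ π′ (shift₂ p)
      ≡⟨⟩
    (nth π p <ᵇ n) ∧ ((nth π p <ᵇ suc n) ∧ allᵇ below-π′ (applyUpTo shift₂ p))
      ≡⟨ cong₂ (λ u v → u ∧ (v ∧ allᵇ below-π′ (applyUpTo shift₂ p)))
               (<ᵇ-true⁺ (entry<n p p<n)) (<ᵇ-true⁺ (≤-trans (entry<n p p<n) (n≤1+n _))) ⟩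
    allᵇ below-π′ (applyUpTo shift₂ p)
      ≡⟨ cong (allᵇ below-π′) (sym (map-upTo shift₂ p)) ⟩
    allᵇ below-π′ (map shift₂ (upTo p))
      ≡⟨ allᵇ-map _ shift₂ (upTo p) ⟩
    isLRminᵇ π p ∎
    where
    open ≡-Reasoning
    below-π′ = λ j → nth π p <ᵇ nth π′ j

  ks-prepend : ks π′ ≡ 0 ∷ map shift₂ (ks π)
  ks-prepend = begin
    ks π′
      ≡⟨⟩
    0 ∷ (if (suc n <ᵇ n) ∧ true then 1 ∷ rest else rest)
      ≡⟨ cong (λ b → 0 ∷ (if b ∧ true then 1 ∷ rest else rest)) (<ᵇ-false⁺ (n≤1+n n)) ⟩
    0 ∷ boolFilter (isLRminᵇ π′) (applyUpTo shift₂ n)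
      ≡⟨ cong (λ xs → 0 ∷ boolFilter (isLRminᵇ π′) xs) (sym (map-upTo shift₂ n)) ⟩
    0 ∷ boolFilter (isLRminᵇ π′) (map shift₂ (upTo n))
      ≡⟨ cong (0 ∷_) (boolFilter-map (isLRminᵇ π′) shift₂ (upTo n)) ⟩
    0 ∷ map shift₂ (boolFilter (λ x → isLRminᵇ π′ (shift₂ x)) (upTo n))
      ≡⟨ cong (λ xs → 0 ∷ map shift₂ xs) (boolFilter-cong (upTo n) (λ p∈ → isLRmin-shift _ (∈-upTo⁻ p∈))) ⟩
    0 ∷ map shift₂ (ks π) ∎
    where
    open ≡-Reasoning
    rest = boolFilter (isLRminᵇ π′) (applyUpTo shift₂ n)

  #ks-prepend : length (ks π′) ≡ suc (length (ks π))
  #ks-prepend = trans (cong length ks-prepend) (cong suc (length-map shift₂ (ks π)))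

  K-prepend : ∀ j₀ → j₀ ≤ length (ks π) → K π′ (shift₂ j₀) ≡ shift₂ (K π (suc j₀))
  K-prepend j₀ j₀≤a = begin
    nth (ks π′ ++ [ shift₂ n ]) (suc j₀)
      ≡⟨ cong (λ xs → nth (xs ++ [ shift₂ n ]) (suc j₀)) ks-prepend ⟩
    nth (map shift₂ (ks π) ++ [ shift₂ n ]) j₀
      ≡⟨ cong (λ xs → nth xs j₀) (sym (map-++ shift₂ (ks π) [ n ])) ⟩
    nth (map shift₂ (ks π ++ [ n ])) j₀
      ≡⟨ nth-map shift₂ (ks π ++ [ n ]) j₀ (subst (j₀ <_) (sym (length-snoc (ks π) n)) (s≤s j₀≤a)) ⟩
    shift₂ (K π (suc j₀)) ∎
    where open ≡-Reasoning

  V-prepend : ∀ i → V π′ (suc i) ≡ V π i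
  V-prepend i = begin
    nth (map (nth π′) (ks π′)) i
      ≡⟨ cong (λ xs → nth (map (nth π′) xs) i) ks-prepend ⟩
    nth (n ∷ map (nth π′) (map shift₂ (ks π))) i
      ≡⟨ cong (λ xs → nth (n ∷ xs) i) (sym (map-∘ (ks π))) ⟩
    V π i ∎
    where open ≡-Reasoning

  nonzero-shift : ∀ {i j} → NonzeroBox π i j → NonzeroBox π′ (suc i) (suc j)
  nonzero-shift {suc i₀} {suc j₀} (b , p , w) =
    record { row≥1 = s≤s z≤n ; row≤col = s≤s (Box.row≤col b) ; col≤a = subst (suc (suc j₀) ≤_) (sym #ks-prepend) (s≤s (Box.col≤a b)) } ,
    shift₂ p ,
    record
      { p<n    = s≤s (s≤s (InBox.p<n w))
      ; after  = subst (_< shift₂ p) (sym (K-prepend j₀ (<⇒≤ (Box.col≤a b)))) (s≤s (s≤s (InBox.after w)))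
      ; before = subst (shift₂ p <_) (sym (K-prepend (suc j₀) (Box.col≤a b))) (s≤s (s≤s (InBox.before w)))
      ; above  = subst (_< nth π p) (sym (V-prepend (suc i₀))) (InBox.above w)
      ; below  = subst (nth π p <_) (sym (V-prepend i₀)) (InBox.below w)
      }

  nonzero-corner : NonzeroBox π′ 1 1
  nonzero-corner =
    record { row≥1 = s≤s z≤n ; row≤col = ≤-refl ; col≤a = subst (1 ≤_) (sym #ks-prepend) (s≤s z≤n) } ,
    1 ,
    record
      { p<n    = s≤s (s≤s z≤n)
      ; after  = subst (_< 1) (sym (cong (λ xs → nth (xs ++ [ shift₂ n ]) 0) ks-prepend)) (s≤s z≤n)
      ; before = subst (1 <_) (sym (K-prepend 0 z≤n)) (s≤s (s≤s z≤n))
      ; above  = subst (_< suc n) (sym (V-prepend 0)) ≤-refl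
      ; below  = ≤-refl
      }

  -- The two new entries exceed everything after them, so they cannot play
  -- the role of the "1" in a 132; hence the pattern lives inside π.
  pattern-prepend : ∀ {p q r} → Pattern132 π′ p q r → Pattern132 π (pred (pred p)) (pred (pred q)) (pred (pred r))
  pattern-prepend {zero} {_} {suc (suc r)} o =
    ⊥-elim (<⇒≱ (Pattern132.πp<πr o) (<⇒≤ (entry<n r (≤-pred (≤-pred (Pattern132.r<n o))))))
  pattern-prepend {suc zero} {_} {suc (suc r)} o =
    ⊥-elim (<⇒≱ (Pattern132.πp<πr o) (≤-trans (<⇒≤ (entry<n r (≤-pred (≤-pred (Pattern132.r<n o))))) (n≤1+n n)))
  pattern-prepend {suc (suc p)} {suc (suc q)} {suc (suc r)} o = record
    { p<q = ≤-pred (≤-pred p<q) ; q<r = ≤-pred (≤-pred q<r) ; r<n = ≤-pred (≤-pred r<n) ; πp<πr = πp<πr ; πr<πq = πr<πq }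
    where open Pattern132 o
  pattern-prepend {r = zero}     o with () ← pattern-end≥2 o
  pattern-prepend {r = suc zero} o with s≤s () ← pattern-end≥2 o
  pattern-prepend {suc (suc p)} {zero} {suc (suc r)} o with () ← Pattern132.p<q o
  pattern-prepend {suc (suc p)} {suc zero} {suc (suc r)} o with s≤s () ← Pattern132.p<q o

  avoids-prepend : contains132ᵇ π ≡ false → contains132ᵇ π′ ≡ false
  avoids-prepend = avoidance-transfer π π′ (λ o → _ , _ , _ , pattern-prepend o)

-- The LR minima are unchanged while K (a+1) and V 0 grow by one, so every
-- nonzero box of π survives, and the new last entry fills the box (1 , a).

nth-snoc-mono : ∀ (xs : List ℕ) y y′ i → y ≤ y′ → nth (xs ++ [ y ]) i ≤ nth (xs ++ [ y′ ]) i
nth-snoc-mono []       y y′ zero    y≤y′ = y≤y′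
nth-snoc-mono []       y y′ (suc i) _    = z≤n
nth-snoc-mono (x ∷ xs) y y′ zero    _    = ≤-refl
nth-snoc-mono (x ∷ xs) y y′ (suc i) y≤y′ = nth-snoc-mono xs y y′ i y≤y′

nth-last-entry : ∀ {n} (x : ℕ) (xs : List ℕ) y → All (_< n) (x ∷ xs) → nth ((x ∷ xs) ++ [ y ]) (length (x ∷ xs) ∸ 1) < n
nth-last-entry x []        y (x<n ∷ _)  = x<n
nth-last-entry x (x′ ∷ xs) y (_ ∷ rest) = nth-last-entry x′ xs y rest

module Append (x : ℕ) (ρ : List ℕ) (bounded : All (_< suc (length ρ)) (x ∷ ρ)) where
  π : List ℕ
  π = x ∷ ρ

  n : ℕ
  n = length π

  π′ : List ℕ
  π′ = π ++ [ n ]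

  length-append : length π′ ≡ suc n
  length-append = length-snoc π n

  nth-append : ∀ p → p < n → nth π′ p ≡ nth π p
  nth-append p p<n = nth-++ˡ π [ n ] p p<n

  x<n : x < n
  x<n = All.lookup bounded (here refl)

  ks-append : ks π′ ≡ ks π
  ks-append = begin
    boolFilter (isLRminᵇ π′) (upTo (length π′))
      ≡⟨ cong (λ m → boolFilter (isLRminᵇ π′) (upTo m)) length-append ⟩
    boolFilter (isLRminᵇ π′) (upTo (suc n))
      ≡⟨ cong (boolFilter (isLRminᵇ π′)) (sym (upTo-∷ʳ n)) ⟩
    boolFilter (isLRminᵇ π′) (upTo n ++ [ n ])
      ≡⟨ boolFilter-++ (isLRminᵇ π′) (upTo n) [ n ] ⟩
    boolFilter (isLRminᵇ π′) (upTo n) ++ boolFilter (isLRminᵇ π′) [ n ]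
      ≡⟨ cong₂ _++_ (boolFilter-cong (upTo n) (λ p∈ → isLRmin-old _ (∈-upTo⁻ p∈)))
                    (cong (λ b → if b then [ n ] else []) last-not-min) ⟩
    ks π ++ []
      ≡⟨ ++-identityʳ (ks π) ⟩
    ks π ∎
    where
    open ≡-Reasoning
    isLRmin-old : ∀ p → p < n → isLRminᵇ π′ p ≡ isLRminᵇ π p
    isLRmin-old p p<n = allᵇ-cong (upTo p) (λ {j} j∈ → cong₂ _<ᵇ_ (nth-append p p<n) (nth-append j (<-trans (∈-upTo⁻ j∈) p<n)))
    -- the new entry n exceeds the first entry x
    last-not-min : isLRminᵇ π′ n ≡ false
    last-not-min = allᵇ-false {p = λ j → nth π′ n <ᵇ nth π′ j} {x = 0} {xs = upTo n} (∈-upTo⁺ (s≤s z≤n)) (trans (cong (_<ᵇ x) (nth-last π n)) (<ᵇ-false⁺ (<⇒≤ x<n)))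

  K-append : ∀ j → K π′ j ≡ nth (ks π ++ [ suc n ]) (j ∸ 1)
  K-append j = cong₂ (λ A B → nth (A ++ [ B ]) (j ∸ 1)) ks-append length-append

  V-append : ∀ i → V π′ i ≡ nth (suc n ∷ map (nth π) (ks π)) i
  V-append i = cong₂ (λ A B → nth (A ∷ B) i) length-append
    (trans (cong (map (nth π′)) ks-append) (map-cong-local (All.map (λ {p} → nth-append p) (ks-bounded π))))

  V-grows : ∀ i → V π i ≤ V π′ i
  V-grows zero    = subst (n ≤_) (sym (V-append zero)) (n≤1+n n)
  V-grows (suc i) = ≤-reflexive (sym (V-append (suc i)))

  K-same : ∀ j₀ → j₀ < length (ks π) → K π′ (suc j₀) ≡ K π (suc j₀)
  K-same j₀ j₀<a = trans (K-append (suc j₀)) (trans (nth-++ˡ (ks π) _ j₀ j₀<a) (sym (nth-++ˡ (ks π) _ j₀ j₀<a)))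

  K-grows : ∀ j → K π j ≤ K π′ j
  K-grows j = subst (K π j ≤_) (sym (K-append j)) (nth-snoc-mono (ks π) n (suc n) (j ∸ 1) (n≤1+n n))

  nonzero-keep : ∀ {i j} → NonzeroBox π i j → NonzeroBox π′ i j
  nonzero-keep {suc i₀} {suc j₀} (b , p , w) =
    record { row≥1 = Box.row≥1 b ; row≤col = Box.row≤col b ; col≤a = subst (suc j₀ ≤_) (sym (cong length ks-append)) (Box.col≤a b) } ,
    p ,
    record
      { p<n    = subst (p <_) (sym length-append) (<-trans (InBox.p<n w) (n<1+n n))
      ; after  = subst (_< p) (sym (K-same j₀ (Box.col≤a b))) (InBox.after w)
      ; before = <-≤-trans (InBox.before w) (K-grows (suc (suc j₀)))
      ; above  = subst₂ _<_ (sym (V-append (suc i₀))) (sym (nth-append p (InBox.p<n w))) (InBox.above w)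
      ; below  = subst (_< V π′ i₀) (sym (nth-append p (InBox.p<n w))) (<-≤-trans (InBox.below w) (V-grows i₀))
      }

  ks-starts-at-0 : Σ (List ℕ) (λ t → ks π ≡ 0 ∷ t)
  ks-starts-at-0 = _ , refl

  -- The appended entry n, after the last LR minimum and above π_{k_1} = x,
  -- is counted in box (1 , a).
  nonzero-last-column : NonzeroBox π′ 1 (length (ks π))
  nonzero-last-column with ks-starts-at-0
  ... | t , ks≡ =
    record { row≥1 = s≤s z≤n ; row≤col = subst (1 ≤_) (sym (cong length ks≡)) (s≤s z≤n) ; col≤a = ≤-reflexive (sym (cong length ks-append)) } ,
    n ,
    record
      { p<n    = subst (n <_) (sym length-append) (n<1+n n)
      ; after  = subst (_< n) (sym (trans (K-append (length (ks π))) (cong (λ xs → nth (xs ++ [ suc n ]) (length xs ∸ 1)) ks≡))) last-min<n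
      ; before = subst (n <_) (sym (trans (K-append (suc (length (ks π)))) (nth-last (ks π) (suc n)))) (n<1+n n)
      ; above  = subst₂ _<_ (sym (trans (V-append 1) (cong (λ xs → nth (map (nth π) xs) 0) ks≡))) (sym (nth-last π n)) x<n
      ; below  = subst₂ _<_ (sym (nth-last π n)) (sym (V-append 0)) (n<1+n n)
      }
    where
    last-min<n : nth ((0 ∷ t) ++ [ suc n ]) (length (0 ∷ t) ∸ 1) < n
    last-min<n = nth-last-entry 0 t (suc n) (subst (All (_< n)) ks≡ (ks-bounded π))

  -- The appended maximum cannot be the "2" of a 132 (it would exceed the "3").
  pattern-append : ∀ {p q r} → Pattern132 π′ p q r → Pattern132 π p q r
  pattern-append {p} {q} {r} o with m≤n⇒m<n∨m≡n (≤-pred (subst (r <_) length-append (Pattern132.r<n o)))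
  ... | inj₁ r<|π| = record
    { p<q = p<q ; q<r = q<r ; r<n = r<|π|
    ; πp<πr = subst₂ _<_ (nth-append p (<-trans p<q q<|π|)) (nth-append r r<|π|) πp<πr
    ; πr<πq = subst₂ _<_ (nth-append r r<|π|) (nth-append q q<|π|) πr<πq }
    where
    open Pattern132 o hiding (r<n)
    q<|π| = <-trans q<r r<|π|
  ... | inj₂ refl = ⊥-elim (<⇒≱ (Pattern132.πr<πq o)
                      (subst₂ _≤_ (sym (nth-append q (Pattern132.q<r o))) (sym (nth-last π n))
                              (<⇒≤ (All.lookup bounded (nth-∈ π q (Pattern132.q<r o))))))

  avoids-append : contains132ᵇ π ≡ false → contains132ᵇ π′ ≡ false
  avoids-append = avoidance-transfer π π′ (λ o → _ , _ , _ , pattern-append o)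


maxBoxes : ℕ → ℕ
maxBoxes ℓ = (2 * ℓ ∸ 1) / 3

maxBoxes-step : ∀ l → maxBoxes (suc (suc (suc (suc l)))) ≡ suc (suc (maxBoxes (suc l)))
maxBoxes-step l = begin
  (2 * suc (suc (suc (suc l))) ∸ 1) / 3  ≡⟨ cong (λ z → (z ∸ 1) / 3) (expand l) ⟩
  (suc (2 * l) + 6) / 3                  ≡⟨ +-distrib-/-∣ʳ (suc (2 * l)) {6} {3} (divides 2 refl) ⟩
  suc (2 * l) / 3 + 2                    ≡⟨ +-comm (suc (2 * l) / 3) 2 ⟩
  suc (suc (suc (2 * l) / 3))            ≡⟨ cong (λ z → suc (suc ((z ∸ 1) / 3))) (sym (double-suc l)) ⟩
  suc (suc (maxBoxes (suc l)))           ∎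
  where
  open ≡-Reasoning
  expand : ∀ l → 2 * suc (suc (suc (suc l))) ≡ suc (suc (2 * l) + 6)
  expand = solve-∀
  double-suc : ∀ l → 2 * suc l ≡ suc (suc (2 * l))
  double-suc = solve-∀

grow : List ℕ → List ℕ
grow π = (length π ∷ suc (length π) ∷ π) ++ [ suc (suc (length π)) ]

extremal : ℕ → List ℕ
extremal 0 = []
extremal 1 = 0 ∷ []
extremal 2 = 0 ∷ 1 ∷ []
extremal 3 = 0 ∷ 1 ∷ 2 ∷ []
extremal (suc (suc (suc (suc l)))) = grow (extremal (suc l))

record Extremal (ℓ : ℕ) (π : List ℕ) : Set where
  field
    length≡  : length π ≡ ℓ
    bounded  : All (_< ℓ) π
    distinct : AllPairs _≢_ π
    avoids   : contains132ᵇ π ≡ false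
    shown          : List (ℕ × ℕ)
    shown-distinct : AllPairs _≢_ shown
    shown-nonzero  : All (λ b → NonzeroBox π (proj₁ b) (proj₂ b)) shown
    shown-count    : length shown ≡ maxBoxes ℓ

extremal₁ : Extremal 1 (0 ∷ [])
extremal₁ = record
  { length≡ = refl ; bounded = s≤s z≤n ∷ [] ; distinct = [] ∷ [] ; avoids = refl
  ; shown = [] ; shown-distinct = [] ; shown-nonzero = [] ; shown-count = refl }

-- E 2 and E 3 arise from E 1 by appending maxima; (1 , 1) is nonzero in both.
extremal₂-corner : NonzeroBox (0 ∷ 1 ∷ []) 1 1
extremal₂-corner = Append.nonzero-last-column 0 [] (s≤s z≤n ∷ [])

extremal₂ : Extremal 2 (0 ∷ 1 ∷ [])
extremal₂ = record
  { length≡ = refl ; bounded = s≤s z≤n ∷ s≤s (s≤s z≤n) ∷ [] ; distinct = ((λ ()) ∷ []) ∷ [] ∷ [] ; avoids = refl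
  ; shown = (1 , 1) ∷ [] ; shown-distinct = [] ∷ [] ; shown-nonzero = extremal₂-corner ∷ [] ; shown-count = refl }

extremal₃ : Extremal 3 (0 ∷ 1 ∷ 2 ∷ [])
extremal₃ = record
  { length≡ = refl ; bounded = s≤s z≤n ∷ s≤s (s≤s z≤n) ∷ s≤s (s≤s (s≤s z≤n)) ∷ []
  ; distinct = ((λ ()) ∷ (λ ()) ∷ []) ∷ ((λ ()) ∷ []) ∷ [] ∷ [] ; avoids = refl
  ; shown = (1 , 1) ∷ [] ; shown-distinct = [] ∷ []
  ; shown-nonzero = Append.nonzero-keep 0 (1 ∷ []) (s≤s z≤n ∷ s≤s (s≤s z≤n) ∷ []) extremal₂-corner ∷ []
  ; shown-count = refl }

distinct-prepend : ∀ {n} {π : List ℕ} → All (_< n) π → AllPairs _≢_ π → AllPairs _≢_ (n ∷ suc n ∷ π)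
distinct-prepend {n} below d =
  ((<⇒≢ (n<1+n n)) ∷ All.map (λ x<n n≡x → <⇒≢ x<n (sym n≡x)) below)
  ∷ All.map (λ x<n n+1≡x → <⇒≢ (≤-trans x<n (n≤1+n n)) (sym n+1≡x)) below
  ∷ d

distinct-append : ∀ {m} {xs : List ℕ} → All (_< m) xs → AllPairs _≢_ xs → AllPairs _≢_ (xs ++ [ m ])
distinct-append below d = AllPairsP.++⁺ d ([] ∷ []) (All.map (λ x<m → <⇒≢ x<m ∷ []) below)

shiftBox : ℕ × ℕ → ℕ × ℕ
shiftBox (i , j) = (suc i , suc j)

shiftBox-injective : ∀ {b b′} → shiftBox b ≡ shiftBox b′ → b ≡ b′
shiftBox-injective {i , j} refl = refl

module Grow (x : ℕ) (ρ : List ℕ) (E : Extremal (suc (length ρ)) (x ∷ ρ)) where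
  open Extremal E

  π : List ℕ
  π = x ∷ ρ

  n : ℕ
  n = length π

  π₁ : List ℕ
  π₁ = n ∷ suc n ∷ π

  -- the bound on π₁ in the form required by Append
  bounded₁ : All (_< suc (suc n)) π₁
  bounded₁ = ≤-trans (n<1+n n) (n≤1+n _) ∷ n<1+n _ ∷ All.map (λ x<n → ≤-trans x<n (≤-trans (n≤1+n n) (n≤1+n _))) bounded

  module P = Prepend π bounded
  module A = Append n (suc n ∷ π) bounded₁

  -- π₁ has at least two LR minima: position 0 and the shifted position 0 of π.
  a₁≢1 : length (ks π₁) ≢ 1
  a₁≢1 e with () ← suc-injective (trans (sym P.#ks-prepend) e)

  row≥2 : ∀ {b} → NonzeroBox π (proj₁ b) (proj₂ b) → 1 ≢ proj₁ (shiftBox b)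
  row≥2 (b , _) e with () ← subst (1 ≤_) (suc-injective (sym e)) (Box.row≥1 b)

  new-shown : List (ℕ × ℕ)
  new-shown = (1 , length (ks π₁)) ∷ (1 , 1) ∷ map shiftBox shown

  new-distinct : AllPairs _≢_ new-shown
  new-distinct =
    ((λ e → a₁≢1 (cong proj₂ e)) ∷ AllP.map⁺ (All.map (λ nz e → row≥2 nz (cong proj₁ e)) shown-nonzero))
    ∷ AllP.map⁺ (All.map (λ nz e → row≥2 nz (cong proj₁ e)) shown-nonzero)
    ∷ AllPairsP.map⁺ (AllPairs.map (λ b≢b′ e → b≢b′ (shiftBox-injective e)) shown-distinct)

  new-nonzero : All (λ b → NonzeroBox (grow π) (proj₁ b) (proj₂ b)) new-shown
  new-nonzero = A.nonzero-last-column
              ∷ A.nonzero-keep P.nonzero-corner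
              ∷ AllP.map⁺ (All.map (λ nz → A.nonzero-keep (P.nonzero-shift nz)) shown-nonzero)

  grown : Extremal (suc (suc (suc (suc (length ρ))))) (grow π)
  grown = record
    { length≡  = length-snoc π₁ (suc (suc n))
    ; bounded  = AllP.++⁺ (All.map (λ x<m → ≤-trans x<m (n≤1+n _)) bounded₁) (≤-refl ∷ [])
    ; distinct = distinct-append bounded₁ (distinct-prepend bounded distinct)
    ; avoids   = A.avoids-append (P.avoids-prepend avoids)
    ; shown          = new-shown
    ; shown-distinct = new-distinct
    ; shown-nonzero  = new-nonzero
    ; shown-count    = trans (cong (λ z → suc (suc z)) (trans (length-map shiftBox shown) shown-count))
                             (sym (maxBoxes-step (length ρ)))
    }

grow-extremal : ∀ L π → Extremal (suc L) π → Extremal (suc (suc (suc (suc L)))) (grow π)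
grow-extremal L [] E with () ← Extremal.length≡ E
grow-extremal L (x ∷ ρ) E with Extremal.length≡ E
... | refl = Grow.grown x ρ E

extremal-is-extremal : ∀ l → Extremal (suc l) (extremal (suc l))
extremal-is-extremal 0 = extremal₁
extremal-is-extremal 1 = extremal₂
extremal-is-extremal 2 = extremal₃
extremal-is-extremal (suc (suc (suc l))) = grow-extremal l (extremal (suc l)) (extremal-is-extremal l)

perms-complete : ∀ ℓ (π : List ℕ) → length π ≡ ℓ → All (_< ℓ) π → AllPairs _≢_ π → π ∈ perms ℓ
perms-complete ℓ π length≡ bounded distinct =
  boolFilter-∈⁺ (allLists-complete ℓ ℓ π length≡ bounded) is-perm
  where
  is-perm : isPermᵇ ℓ π ≡ true
  is-perm rewrite ≡ᵇ-true⁺ length≡ | allᵇ⁺ {p = λ x → x <ᵇ ℓ} (All.map <ᵇ-true⁺ bounded)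
                | distinctᵇ⁺ π distinct = refl

perms-length : ∀ ℓ {σ} → σ ∈ perms ℓ → length σ ≡ ℓ
perms-length ℓ {σ} σ∈ = ≡ᵇ-true⁻ (proj₁ (∧-true {length σ ≡ᵇ ℓ} (proj₂ (boolFilter-∈⁻ (allLists ℓ ℓ) σ∈))))

J-positive : ∀ ℓ k {π} → π ∈ perms ℓ → contains132ᵇ π ≡ false → nonzeroBoxes π ≡ k → J ℓ k ≢ 0
J-positive ℓ k {π} π∈ avoids count≡k =
  ∈⇒length≢0 (boolFilter-∈⁺ {p = λ π → avoids132ᵇ π ∧ (nonzeroBoxes π ≡ᵇ k)} π∈ passes)
  where
  passes : avoids132ᵇ π ∧ (nonzeroBoxes π ≡ᵇ k) ≡ true
  passes rewrite avoids = ≡ᵇ-true⁺ count≡k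

J-vanishes : ∀ ℓ k → (∀ {σ} → σ ∈ perms ℓ → contains132ᵇ σ ≡ false → nonzeroBoxes σ ≢ k) → J ℓ k ≡ 0
J-vanishes ℓ k count≢k = boolFilter-none (perms ℓ) fails
  where
  fails : ∀ {σ} → σ ∈ perms ℓ → (avoids132ᵇ σ ∧ (nonzeroBoxes σ ≡ᵇ k)) ≡ false
  fails {σ} σ∈ with contains132ᵇ σ in c
  ... | true  = refl
  ... | false = ≡ᵇ-false⁺ (count≢k σ∈ c)

extremal-count : ∀ l → nonzeroBoxes (extremal (suc l)) ≡ maxBoxes (suc l)
extremal-count l = ≤-antisym
  (subst (λ m → nonzeroBoxes π ≤ maxBoxes m) length≡ (upper-bound π avoids))
  (subst (_≤ nonzeroBoxes π) shown-count
    (distinct-images-length (λ b → b) shown-distinct (All.map (nonzero⁺ π) shown-nonzero)))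
  where
  π = extremal (suc l)
  open Extremal (extremal-is-extremal l)

proposition2p7 : (ℓ : ℕ) → 1 ≤ ℓ →
    (J ℓ ((2 * ℓ ∸ 1) / 3) ≢ 0) × ((k : ℕ) → (2 * ℓ ∸ 1) / 3 < k → J ℓ k ≡ 0)
proposition2p7 (suc l) _ = attained , beyond-bound
  where
  open Extremal (extremal-is-extremal l)
  attained : J (suc l) (maxBoxes (suc l)) ≢ 0
  attained = J-positive (suc l) _ (perms-complete (suc l) _ length≡ bounded distinct) avoids (extremal-count l)
  beyond-bound : (k : ℕ) → maxBoxes (suc l) < k → J (suc l) k ≡ 0
  beyond-bound k max<k = J-vanishes (suc l) k (λ {σ} σ∈ σ-avoids count≡k →
    <⇒≱ max<k (subst (λ m → k ≤ maxBoxes m) (perms-length (suc l) σ∈)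
                     (subst (_≤ maxBoxes (length σ)) count≡k (upper-bound σ σ-avoids))))
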